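{- Let $G$ be a finite simple undirected cubic (3-regular) graph and let $\varphi$ be an edge labeling of $G$. Then $$|V_{int}(G,\varphi)|\leq\left\lfloor\frac{3\cdot|V(G)|-2}{4}\right\rfloor.$$
   Context: An interval is a nonempty finite set of consecutive integers. An edge labeling of a graph $G$ is an injective function $\varphi:E(G)\to\{1,2,\dots,|E(G)|\}$. For a vertex $x$, its spectrum is $S_G(x,\varphi)=\{\varphi(e): e\in E(G),\ e \text{ incident with } x\}$, and $V_{int}(G,\varphi)=\{x\in V(G): S_G(x,\varphi)\text{ is an interval}\}$. -}

module Defs where

open import Data.Nat using (ℕ; _≤_; suc)
open import Data.Fin using (Fin; _≟_)
open import Data.Fin.Subset using (Subset; ∣_∣)
open import Data.Bool using (Bool; true; _∨_)
open import Data.Vec using (tabulate)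
open import Data.Product using (_×_; proj₁; proj₂; ∃; _,_)
open import Data.Sum using (_⊎_)
open import Relation.Nullary using (¬_; does)
open import Relation.Binary.PropositionalEquality using (_≡_; _≢_)

record Graph : Set where
  field
    n    : ℕ
    m    : ℕ
    ends : Fin m → Fin n × Fin n
    loopless : ∀ e → proj₁ (ends e) ≢ proj₂ (ends e)
    simple   : ∀ e f →
      ((proj₁ (ends e) ≡ proj₁ (ends f) × proj₂ (ends e) ≡ proj₂ (ends f))
       ⊎ (proj₁ (ends e) ≡ proj₂ (ends f) × proj₂ (ends e) ≡ proj₁ (ends f)))
      → e ≡ f

open Graph public

∣V∣ : Graph → ℕ
∣V∣ G = n G

∣E∣ : Graph → ℕ
∣E∣ G = m G

incident : (G : Graph) → Fin (m G) → Fin (n G) → Bool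
incident G e x = does (proj₁ (ends G e) ≟ x) ∨ does (proj₂ (ends G e) ≟ x)

incidentEdges : (G : Graph) → Fin (n G) → Subset (m G)
incidentEdges G x = tabulate (λ e → incident G e x)

degree : (G : Graph) → Fin (n G) → ℕ
degree G x = ∣ incidentEdges G x ∣

Cubic : Graph → Set
Cubic G = ∀ x → degree G x ≡ 3

record EdgeLabeling (G : Graph) : Set where
  field
    φ      : Fin (m G) → ℕ
    range  : ∀ e → 1 ≤ φ e × φ e ≤ m G
    inj    : ∀ e f → φ e ≡ φ f → e ≡ f

open EdgeLabeling public

_∈Spec_ : ∀ {G} → ℕ → (Fin (n G) × EdgeLabeling G) → Set
_∈Spec_ {G} l (x , L) = ∃ λ e → incident G e x ≡ true × φ L e ≡ l

IsInterval : (ℕ → Set) → Set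
IsInterval S = (∃ λ a → S a) × (∀ a b c → S a → S b → a ≤ c → c ≤ b → S c)

InVint : (G : Graph) → EdgeLabeling G → Fin (n G) → Set
InVint G L x = IsInterval (λ l → _∈Spec_ {G} l (x , L))

-- A vertex of degree 3 with an interval spectrum carries labels s, s + 1, s + 2,
-- hence the two consecutive pairs (s, s + 1) and (s + 1, s + 2).  In a simple graph
-- two distinct vertices share at most one edge, hence at most one label, so no pair
-- (t, t + 1) is carried by two vertices.  Thus the 2 |V_int| pairs are distinct, and
-- their smaller labels are distinct elements of {1, …, |E| − 1}; with 2 |E| = 3 |V|
-- this gives 4 |V_int| ≤ 3 |V| − 2.

module Submission where

open import Defs
open import Data.Nat using (ℕ; _≤_; _*_; _∸_; _/_)
open import Data.Fin.Subset using (Subset; _∈_; ∣_∣)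
open import Function.Bundles using (_⇔_; Equivalence)

open import Data.Bool using (Bool; true; false; _∨_)
open import Data.Empty using (⊥; ⊥-elim)
open import Data.Fin using (Fin; zero; suc; toℕ; fromℕ<; inject≤; remQuot; combine; _≟_)
import Data.Fin.Properties as Fin
open import Data.Nat using (_+_; _<_; s≤s; NonZero)
open import Data.Nat.DivMod using (m*n/n≡m; /-monoˡ-≤)
open import Data.Nat.Properties
  using (+-0-commutativeMonoid; <-cmp; ≤-trans; ≤-reflexive; <⇒≤; +-comm; +-suc; +-cancelˡ-≡;
         +-monoʳ-≤; m≤m+n; 1+n≢n; *-assoc; *-comm; *-zeroʳ; *-monoˡ-≤; *-distribʳ-∸;
         ∸-monoˡ-<; ∸-cancelʳ-≡; module ≤-Reasoning)
open import Algebra.Properties.CommutativeMonoid.Sum +-0-commutativeMonoid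
  using (sum-syntax; sum-cong-≗; ∑-comm; ∑-distrib-+)
open import Data.Product using (∃; ∃₂; _×_; _,_; proj₁; proj₂; uncurry)
open import Data.Sum using (_⊎_; inj₁; inj₂)
open import Data.Vec using (_∷_; tabulate; here; there)
open import Data.Vec.Properties using ([]=⇒lookup; lookup∘tabulate)
open import Function using (_∘_)
open import Function.Definitions using (Injective)
open import Relation.Binary.Definitions using (tri<; tri≈; tri>)
open import Relation.Binary.PropositionalEquality
  using (_≡_; _≢_; refl; sym; trans; cong; cong₂; subst; module ≡-Reasoning)
open import Relation.Nullary using (Dec; yes; no; does; contradiction)

enumerate : ∀ {k} (p : Subset k) → Fin ∣ p ∣ → Fin k
enumerate (true ∷ p)  zero    = zero
enumerate (true ∷ p)  (suc i) = suc (enumerate p i)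
enumerate (false ∷ p) i       = suc (enumerate p i)

enumerate-∈ : ∀ {k} (p : Subset k) i → enumerate p i ∈ p
enumerate-∈ (true ∷ p)  zero    = here
enumerate-∈ (true ∷ p)  (suc i) = there (enumerate-∈ p i)
enumerate-∈ (false ∷ p) i       = there (enumerate-∈ p i)

enumerate-injective : ∀ {k} (p : Subset k) → Injective _≡_ _≡_ (enumerate p)
enumerate-injective (true ∷ p)  {zero}  {zero}  _  = refl
enumerate-injective (true ∷ p)  {suc i} {suc j} eq = cong suc (enumerate-injective p (Fin.suc-injective eq))
enumerate-injective (false ∷ p) eq = enumerate-injective p (Fin.suc-injective eq)

∈-tabulate⁻ : ∀ {k} (f : Fin k → Bool) {i} → i ∈ tabulate f → f i ≡ true
∈-tabulate⁻ f {i} i∈ = trans (sym (lookup∘tabulate f i)) ([]=⇒lookup i∈)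

indicator : Bool → ℕ
indicator true  = 1
indicator false = 0

∣tabulate∣≡∑ : ∀ {k} (f : Fin k → Bool) → ∣ tabulate f ∣ ≡ ∑[ i < k ] indicator (f i)
∣tabulate∣≡∑ {ℕ.zero}  f = refl
∣tabulate∣≡∑ {ℕ.suc k} f with f zero
... | true  = cong ℕ.suc (∣tabulate∣≡∑ (f ∘ suc))
... | false = ∣tabulate∣≡∑ (f ∘ suc)

∑-const : ∀ k c → ∑[ i < k ] c ≡ k * c
∑-const ℕ.zero    c = refl
∑-const (ℕ.suc k) c = cong (c +_) (∑-const k c)

∑-indicator-≟ : ∀ {k} (a : Fin k) → ∑[ x < k ] indicator (does (a ≟ x)) ≡ 1
∑-indicator-≟ {ℕ.suc k} zero    = cong ℕ.suc (trans (∑-const k 0) (*-zeroʳ k))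
∑-indicator-≟ {ℕ.suc k} (suc a) = ∑-indicator-≟ a

indicator-∨ : ∀ {P Q : Set} (P? : Dec P) (Q? : Dec Q) → (P → Q → ⊥) →
  indicator (does P? ∨ does Q?) ≡ indicator (does P?) + indicator (does Q?)
indicator-∨ (yes p) (yes q) excl = ⊥-elim (excl p q)
indicator-∨ (yes _) (no _)  _    = refl
indicator-∨ (no _)  (yes _) _    = refl
indicator-∨ (no _)  (no _)  _    = refl

∨-true⁻ : ∀ {P Q : Set} (P? : Dec P) (Q? : Dec Q) → (does P? ∨ does Q?) ≡ true → P ⊎ Q
∨-true⁻ (yes p) _       _ = inj₁ p
∨-true⁻ (no _)  (yes q) _ = inj₂ q

m*n≤o⇒m≤o/n : ∀ m n {o} .{{_ : NonZero n}} → m * n ≤ o → m ≤ o / n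
m*n≤o⇒m≤o/n m n m*n≤o = ≤-trans (≤-reflexive (sym (m*n/n≡m m n))) (/-monoˡ-≤ n m*n≤o)

injective-into-range⇒≤ : ∀ {a lo hi} (f : Fin a → ℕ) → Injective _≡_ _≡_ f →
  (∀ i → lo ≤ f i) → (∀ i → f i < hi) → a ≤ hi ∸ lo
injective-into-range⇒≤ {lo = lo} f f-inj lo≤f f<hi = Fin.injective⇒≤ {f = shifted} shifted-injective
  where
  shifted : _ → Fin _
  shifted i = fromℕ< (∸-monoˡ-< (f<hi i) (lo≤f i))
  shifted-injective : Injective _≡_ _≡_ shifted
  shifted-injective {i} {j} eq =
    f-inj (∸-cancelʳ-≡ (lo≤f i) (lo≤f j) (Fin.fromℕ<-injective _ _ _ _ eq))

module _ (f : Fin 3 → ℕ) (f-inj : Injective _≡_ _≡_ f) where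

  private
    <-<⇒2+≤ : ∀ {a b c} → a < b → b < c → 2 + a ≤ c
    <-<⇒2+≤ a<b b<c = ≤-trans (s≤s a<b) b<c

    spread-around : ∀ i j k → f i < f j → f k ≢ f i → f k ≢ f j → ∃₂ λ u w → 2 + f u ≤ f w
    spread-around i j k i<j k≢i k≢j with <-cmp (f k) (f i) | <-cmp (f k) (f j)
    ... | tri< k<i _ _ | _            = k , j , <-<⇒2+≤ k<i i<j
    ... | tri≈ _ k≡i _ | _            = contradiction k≡i k≢i
    ... | tri> _ _ i<k | tri< k<j _ _ = i , j , <-<⇒2+≤ i<k k<j
    ... | tri> _ _ _   | tri≈ _ k≡j _ = contradiction k≡j k≢j
    ... | tri> _ _ _   | tri> _ _ j<k = i , k , <-<⇒2+≤ i<j j<k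

    distinct : ∀ {i j} → i ≢ j → f i ≢ f j
    distinct i≢j = i≢j ∘ f-inj

  spread : ∃₂ λ u w → 2 + f u ≤ f w
  spread with <-cmp (f zero) (f (suc zero))
  ... | tri< 0<1 _ _ = spread-around zero (suc zero) (suc (suc zero)) 0<1 (distinct λ ()) (distinct λ ())
  ... | tri≈ _ 0≡1 _ = contradiction 0≡1 (distinct λ ())
  ... | tri> _ _ 1<0 = spread-around (suc zero) zero (suc (suc zero)) 1<0 (distinct λ ()) (distinct λ ())

module _ (G : Graph) where

  Joins : Fin (m G) → Fin (n G) → Fin (n G) → Set
  Joins e x y = (proj₁ (ends G e) ≡ x × proj₂ (ends G e) ≡ y)
              ⊎ (proj₁ (ends G e) ≡ y × proj₂ (ends G e) ≡ x)

  incident-both⇒joins : ∀ {e x y} → x ≢ y →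
    incident G e x ≡ true → incident G e y ≡ true → Joins e x y
  incident-both⇒joins {e} {x} {y} x≢y e∋x e∋y
    with ∨-true⁻ (proj₁ (ends G e) ≟ x) (proj₂ (ends G e) ≟ x) e∋x
       | ∨-true⁻ (proj₁ (ends G e) ≟ y) (proj₂ (ends G e) ≟ y) e∋y
  ... | inj₁ p | inj₁ q = contradiction (trans (sym p) q) x≢y
  ... | inj₁ p | inj₂ q = inj₁ (p , q)
  ... | inj₂ p | inj₁ q = inj₂ (q , p)
  ... | inj₂ p | inj₂ q = contradiction (trans (sym p) q) x≢y

  joins-unique : ∀ {e f x y} → Joins e x y → Joins f x y → e ≡ f
  joins-unique {e} {f} (inj₁ (p , q)) (inj₁ (p′ , q′)) = simple G e f (inj₁ (trans p (sym p′) , trans q (sym q′)))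
  joins-unique {e} {f} (inj₁ (p , q)) (inj₂ (p′ , q′)) = simple G e f (inj₂ (trans p (sym q′) , trans q (sym p′)))
  joins-unique {e} {f} (inj₂ (p , q)) (inj₁ (p′ , q′)) = simple G e f (inj₂ (trans p (sym q′) , trans q (sym p′)))
  joins-unique {e} {f} (inj₂ (p , q)) (inj₂ (p′ , q′)) = simple G e f (inj₁ (trans p (sym p′) , trans q (sym q′)))

  common-edge-unique : ∀ {e f x y} → x ≢ y →
    incident G e x ≡ true → incident G e y ≡ true →
    incident G f x ≡ true → incident G f y ≡ true → e ≡ f
  common-edge-unique x≢y e∋x e∋y f∋x f∋y =
    joins-unique (incident-both⇒joins x≢y e∋x e∋y) (incident-both⇒joins x≢y f∋x f∋y)

  endpoints-count : ∀ e → ∑[ x < n G ] indicator (incident G e x) ≡ 2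
  endpoints-count e = begin
    ∑[ x < n G ] indicator (does (u ≟ x) ∨ does (v ≟ x))
      ≡⟨ sum-cong-≗ (λ x → indicator-∨ (u ≟ x) (v ≟ x) λ u≡x v≡x → loopless G e (trans u≡x (sym v≡x))) ⟩
    ∑[ x < n G ] (indicator (does (u ≟ x)) + indicator (does (v ≟ x)))
      ≡⟨ ∑-distrib-+ (λ x → indicator (does (u ≟ x))) (λ x → indicator (does (v ≟ x))) ⟩
    ∑[ x < n G ] indicator (does (u ≟ x)) + ∑[ x < n G ] indicator (does (v ≟ x))
      ≡⟨ cong₂ _+_ (∑-indicator-≟ u) (∑-indicator-≟ v) ⟩
    2 ∎
    where
    open ≡-Reasoning
    u = proj₁ (ends G e)
    v = proj₂ (ends G e)

  degree-sum : ∑[ x < n G ] degree G x ≡ m G * 2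
  degree-sum = begin
    ∑[ x < n G ] degree G x
      ≡⟨ sum-cong-≗ (λ x → ∣tabulate∣≡∑ (λ e → incident G e x)) ⟩
    ∑[ x < n G ] ∑[ e < m G ] indicator (incident G e x)
      ≡⟨ ∑-comm (λ x e → indicator (incident G e x)) ⟩
    ∑[ e < m G ] ∑[ x < n G ] indicator (incident G e x)
      ≡⟨ sum-cong-≗ endpoints-count ⟩
    ∑[ e < m G ] 2
      ≡⟨ ∑-const (m G) 2 ⟩
    m G * 2 ∎
    where open ≡-Reasoning

  cubic⇒2∣E∣≡3∣V∣ : Cubic G → m G * 2 ≡ n G * 3
  cubic⇒2∣E∣≡3∣V∣ cubic = begin
    m G * 2                 ≡⟨ degree-sum ⟨
    ∑[ x < n G ] degree G x ≡⟨ sum-cong-≗ cubic ⟩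
    ∑[ x < n G ] 3          ≡⟨ ∑-const (n G) 3 ⟩
    n G * 3                 ∎
    where open ≡-Reasoning

  module _ (L : EdgeLabeling G) where

    label-range : ∀ {x t} → t ∈Spec (x , L) → 1 ≤ t × t ≤ m G
    label-range (e , _ , refl) = range L e

    common-label-unique : ∀ {x y t t′} → x ≢ y →
      t ∈Spec (x , L) → t ∈Spec (y , L) → t′ ∈Spec (x , L) → t′ ∈Spec (y , L) → t ≡ t′
    common-label-unique x≢y (e , e∋x , refl) (e′ , e′∋y , φe′≡t) (f , f∋x , refl) (f′ , f′∋y , φf′≡t′) =
      cong (φ L) (common-edge-unique x≢y e∋x e∋y f∋x f∋y)
      where
      e∋y : incident G e _ ≡ true
      e∋y = subst (λ d → incident G d _ ≡ true) (inj L e′ e φe′≡t) e′∋y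
      f∋y : incident G f _ ≡ true
      f∋y = subst (λ d → incident G d _ ≡ true) (inj L f′ f φf′≡t′) f′∋y

    ConsecutiveTriple : Fin (n G) → ℕ → Set
    ConsecutiveTriple x s = ∀ d → d ≤ 2 → (s + d) ∈Spec (x , L)

    interval⇒consecutiveTriple : ∀ {x} → 3 ≤ degree G x → InVint G L x → ∃ (ConsecutiveTriple x)
    interval⇒consecutiveTriple {x} 3≤deg (_ , closed) = run (spread label label-injective)
      where
      edge : Fin 3 → Fin (m G)
      edge i = enumerate (incidentEdges G x) (inject≤ i 3≤deg)
      label : Fin 3 → ℕ
      label = φ L ∘ edge
      label-injective : Injective _≡_ _≡_ label
      label-injective =
        Fin.inject≤-injective _ _ _ _ ∘ enumerate-injective (incidentEdges G x) ∘ inj L _ _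
      label∈ : ∀ i → label i ∈Spec (x , L)
      label∈ i = edge i , ∈-tabulate⁻ (λ e → incident G e x) (enumerate-∈ (incidentEdges G x) _) , refl
      run : (∃₂ λ u w → 2 + label u ≤ label w) → ∃ (ConsecutiveTriple x)
      run (u , w , 2+u≤w) = label u , λ d d≤2 →
        closed (label u) (label w) (label u + d) (label∈ u) (label∈ w) (m≤m+n (label u) d)
          (≤-trans (+-monoʳ-≤ (label u) d≤2) (subst (_≤ label w) (+-comm 2 (label u)) 2+u≤w))

    consecutiveTriples-bound : (V : Subset (n G)) → (∀ {x} → x ∈ V → ∃ (ConsecutiveTriple x)) →
      ∣ V ∣ * 2 ≤ m G ∸ 1
    consecutiveTriples-bound V triple =
      injective-into-range⇒≤ (pairStart ∘ split) pairStart∘split-injective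
        (λ q → proj₁ (label-range (lower (split q))))
        (λ q → proj₂ (label-range (upper (split q))))
      where
      vertex : Fin ∣ V ∣ → Fin (n G)
      vertex = enumerate V
      start : Fin ∣ V ∣ → ℕ
      start i = proj₁ (triple (enumerate-∈ V i))
      pairStart : Fin ∣ V ∣ × Fin 2 → ℕ
      pairStart (i , j) = start i + toℕ j
      lower : ∀ p → pairStart p ∈Spec (vertex (proj₁ p) , L)
      lower (i , j) = proj₂ (triple (enumerate-∈ V i)) (toℕ j) (<⇒≤ (Fin.toℕ<n j))
      upper : ∀ p → ℕ.suc (pairStart p) ∈Spec (vertex (proj₁ p) , L)
      upper (i , j) = subst (_∈Spec (vertex i , L)) (+-suc (start i) (toℕ j))
        (proj₂ (triple (enumerate-∈ V i)) (ℕ.suc (toℕ j)) (Fin.toℕ<n j))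
      pairStart-injective : Injective _≡_ _≡_ pairStart
      pairStart-injective {i , j} {i′ , j′} eq with i Fin.≟ i′
      ... | yes refl = cong (i ,_) (Fin.toℕ-injective (+-cancelˡ-≡ (start i) _ _ eq))
      ... | no i≢i′ = contradiction
        (common-label-unique (i≢i′ ∘ enumerate-injective V)
          (lower (i , j)) (subst (_∈Spec (vertex i′ , L)) (sym eq) (lower (i′ , j′)))
          (upper (i , j)) (subst (λ t → ℕ.suc t ∈Spec (vertex i′ , L)) (sym eq) (upper (i′ , j′))))
        (1+n≢n ∘ sym)
      split : Fin (∣ V ∣ * 2) → Fin ∣ V ∣ × Fin 2
      split = remQuot 2
      pairStart∘split-injective : Injective _≡_ _≡_ (pairStart ∘ split)
      pairStart∘split-injective {q} {q′} eq = begin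
        q                           ≡⟨ Fin.combine-remQuot {∣ V ∣} 2 q ⟨
        uncurry combine (split q)   ≡⟨ cong (uncurry combine) (pairStart-injective eq) ⟩
        uncurry combine (split q′)  ≡⟨ Fin.combine-remQuot {∣ V ∣} 2 q′ ⟩
        q′                          ∎
        where open ≡-Reasoning

corollary3 : (G : Graph) → Cubic G → (L : EdgeLabeling G) →
    (Vint : Subset (∣V∣ G)) → (∀ x → (x ∈ Vint) ⇔ InVint G L x) →
    ∣ Vint ∣ ≤ (3 * ∣V∣ G ∸ 2) / 4
corollary3 G cubic L Vint Vint⇔ = m*n≤o⇒m≤o/n ∣ Vint ∣ 4 (begin
  ∣ Vint ∣ * 4       ≡⟨ *-assoc ∣ Vint ∣ 2 2 ⟨
  ∣ Vint ∣ * 2 * 2   ≤⟨ *-monoˡ-≤ 2 (consecutiveTriples-bound G L Vint triple) ⟩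
  (m G ∸ 1) * 2      ≡⟨ *-distribʳ-∸ 2 (m G) 1 ⟩
  m G * 2 ∸ 2        ≡⟨ cong (_∸ 2) (cubic⇒2∣E∣≡3∣V∣ G cubic) ⟩
  n G * 3 ∸ 2        ≡⟨ cong (_∸ 2) (*-comm (n G) 3) ⟩
  3 * n G ∸ 2        ∎)
  where
  open ≤-Reasoning
  triple : ∀ {x} → x ∈ Vint → ∃ (ConsecutiveTriple G L x)
  triple {x} x∈Vint = interval⇒consecutiveTriple G L (≤-reflexive (sym (cubic x)))
    (Equivalence.to (Vint⇔ x) x∈Vint)
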